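{- Let $G$ be a ONE-ONE-LQ instance in which a stable matching $M_s$ is feasible, let $s=|M_s|$, and let $G'$ be the instance obtained by the marking construction described in the context. Then every relaxed stable matching in $G'$ has size at most $2s$.
   Context: ONE-ONE-LQ instance: bipartite graph $G=(\mathcal{A}\cup\mathcal{B},E)$ of agents and resources, each vertex with a strict preference order over its neighbours ($\succ_u$), each resource with upper-quota $1$ and lower-quota in $\{0,1\}$ (LQ resource if lower-quota $1$). Matching: each vertex in at most one edge; $M(v)$ partner or $\bot$ (least preferred). Feasible: every LQ resource matched. Blocking pair $(a,b)\in E\setminus M$: $b\succ_a M(a)$ and $a\succ_b M(b)$; stable: no blocking pair. Relaxed stable: every agent $a$ in a blocking pair is matched and $M(a)$ is an LQ resource. $\ell(v)$ = length of $v$'s list. Construction: let $X_A$ (resp. $X_B$) be the agents (resp. resources) matched in $M_s$. For every vertex $v\in X_A\cup X_B$, mark the $\min(2s+1,\ell(v))$ most preferred edges incident to $v$. $G'$ is the ONE-ONE-LQ instance formed by the marked edges and their endpoints, with the same quotas and preference lists of $G$ restricted to neighbours in $G'$. -}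

module Defs where

open import Data.Nat using (ℕ; _*_; _+_)
open import Data.Bool using (Bool; true; false; _∧_; _∨_; not)
open import Data.Fin using (Fin)
open import Data.Fin.Properties using () renaming (_≟_ to _≟F_)
open import Data.List using (List; []; _∷_; _++_; take; filter; null; length)
open import Data.Bool.ListAction using (any)
open import Data.List.Membership.Propositional using (_∈_; _∉_)
open import Data.List.Relation.Unary.Unique.Propositional using (Unique)
open import Data.Product using (_×_; _,_; ∃; ∃-syntax; Σ)
open import Relation.Binary.PropositionalEquality using (_≡_)
open import Relation.Nullary using (¬_)
open import Relation.Nullary.Decidable using (⌊_⌋)
open import Function.Bundles using (_⇔_)

-- The preference list of a vertex is the list of its neighbours, most
-- preferred first.  All resources have upper-quota 1; lq b ≡ true means
-- resource b has lower-quota 1 (an LQ resource), false means lower-quota 0.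
record Instance (nA nB : ℕ) : Set where
  field
    prefA : Fin nA → List (Fin nB)
    prefB : Fin nB → List (Fin nA)
    lq    : Fin nB → Bool
open Instance public

record WellFormed {nA nB : ℕ} (G : Instance nA nB) : Set where
  field
    uniqueA : ∀ a → Unique (prefA G a)
    uniqueB : ∀ b → Unique (prefB G b)
    edgeSym : ∀ a b → (b ∈ prefA G a) ⇔ (a ∈ prefB G b)

Edge : ∀ {nA nB} → Instance nA nB → Fin nA → Fin nB → Set
Edge G a b = b ∈ prefA G a

Before : ∀ {X : Set} → List X → X → X → Set
Before {X} xs x y = Σ (List X) λ ys → Σ (List X) λ zs → (xs ≡ ys ++ (x ∷ zs)) × (y ∈ zs)

Matching : ℕ → ℕ → Set
Matching nA nB = List (Fin nA × Fin nB)

record IsMatching {nA nB : ℕ} (G : Instance nA nB) (M : Matching nA nB) : Set where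
  field
    noDup   : Unique M
    edges   : ∀ {a b} → (a , b) ∈ M → Edge G a b
    agentOK : ∀ {a b b'} → (a , b) ∈ M → (a , b') ∈ M → b ≡ b'
    resOK   : ∀ {a a' b} → (a , b) ∈ M → (a' , b) ∈ M → a ≡ a'

-- b ≻_a M(a)  (if a is unmatched, M(a) = ⊥ and any neighbour is preferred).
PrefA : ∀ {nA nB} → Instance nA nB → Matching nA nB → Fin nA → Fin nB → Set
PrefA G M a b = b ∈ prefA G a × (∀ b' → (a , b') ∈ M → Before (prefA G a) b b')

PrefB : ∀ {nA nB} → Instance nA nB → Matching nA nB → Fin nB → Fin nA → Set
PrefB G M b a = a ∈ prefB G b × (∀ a' → (a' , b) ∈ M → Before (prefB G b) a a')

Blocking : ∀ {nA nB} → Instance nA nB → Matching nA nB → Fin nA → Fin nB → Set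
Blocking G M a b = Edge G a b × (a , b) ∉ M × PrefA G M a b × PrefB G M b a

Stable : ∀ {nA nB} → Instance nA nB → Matching nA nB → Set
Stable G M = ∀ a b → ¬ Blocking G M a b

Feasible : ∀ {nA nB} → Instance nA nB → Matching nA nB → Set
Feasible G M = ∀ b → lq G b ≡ true → ∃[ a ] ((a , b) ∈ M)

RelaxedStable : ∀ {nA nB} → Instance nA nB → Matching nA nB → Set
RelaxedStable G M = ∀ a b → Blocking G M a b → ∃[ b' ] (((a , b') ∈ M) × (lq G b' ≡ true))

memFin : ∀ {n} → Fin n → List (Fin n) → Bool
memFin x xs = any (λ y → ⌊ x ≟F y ⌋) xs

module _ {nA nB : ℕ} (G : Instance nA nB) (Ms : Matching nA nB) where

  inXA : Fin nA → Bool
  inXA a = any (λ p → ⌊ a ≟F Data.Product.proj₁ p ⌋) Ms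

  inXB : Fin nB → Bool
  inXB b = any (λ p → ⌊ b ≟F Data.Product.proj₂ p ⌋) Ms

  bound : ℕ
  bound = 2 * length Ms + 1

  marked : Fin nA → Fin nB → Bool
  marked a b = (inXA a ∧ memFin b (take bound (prefA G a)))
             ∨ (inXB b ∧ memFin a (take bound (prefB G b)))

  -- Vertices not in G' get an empty list
  -- (they are isolated, i.e. absent); a resource is an LQ resource of G'
  -- iff it is an LQ resource of G that belongs to G'.
  G' : Instance nA nB
  prefA G' a = filter (λ b → Data.Bool.T? (marked a b)) (prefA G a)
  prefB G' b = filter (λ a → Data.Bool.T? (marked a b)) (prefB G b)
  lq    G' b = lq G b ∧ not (null (filter (λ a → Data.Bool.T? (marked a b)) (prefB G b)))

-- Every edge of G' is marked, so it has an endpoint matched in Ms.  Send an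
-- edge (a , b) of a matching M of G' to its agent if a is matched in Ms, and
-- to its resource otherwise; since M is a matching this map is injective, so
-- |M| is at most the number of vertices matched in Ms, which is 2s.
module Submission where

open import Defs
open import Data.Nat using (ℕ; _≤_; _+_; _*_; suc; z≤n; s≤s)
open import Data.Nat.Properties using (+-identityʳ; module ≤-Reasoning)
open import Data.List using (List; []; _∷_; _++_; length; map)
open import Data.List.Properties using (length-++; length-map)
open import Data.Bool using (true; false; T; T?; if_then_else_)
open import Data.Bool.Properties using (T-∧; T-∨)
open import Data.Sum using (_⊎_; inj₁; inj₂)
open import Data.Product using (_×_; _,_; proj₁; proj₂; ∃)
open import Data.Fin using (Fin)
open import Data.Empty using (⊥-elim)
open import Relation.Binary.PropositionalEquality using (_≡_; refl; sym; trans; cong; cong₂; subst; module ≡-Reasoning)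
open import Relation.Nullary using (¬_)
open import Relation.Nullary.Decidable using (toWitness)
open import Function.Bundles using (Equivalence)
open import Data.List.Relation.Unary.Any using (here; there)
import Data.List.Relation.Unary.Any as Any
open import Data.List.Relation.Unary.Any.Properties using (any⁻; map⁺)
import Data.List.Relation.Unary.All as All
open import Data.List.Relation.Unary.AllPairs using (_∷_)
open import Data.List.Relation.Unary.Unique.Propositional using (Unique)
open import Data.List.Membership.Propositional using (_∈_)
open import Data.List.Membership.Propositional.Properties using (∈-map⁺; ∈-filter⁻; ∈-++⁺ˡ; ∈-++⁺ʳ)

private
  variable
    X Y : Set

∈⇒removal : ∀ {x : X} {ys} → x ∈ ys →
            ∃ λ ys' → length ys ≡ suc (length ys') × (∀ {z} → z ∈ ys → ¬ z ≡ x → z ∈ ys')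
∈⇒removal {ys = y ∷ ys} (here refl) =
  ys , refl , λ { (here z≡y) z≢y → ⊥-elim (z≢y z≡y) ; (there z∈ys) _ → z∈ys }
∈⇒removal {ys = y ∷ ys} (there x∈ys) with ∈⇒removal x∈ys
... | ys' , len , keep =
  y ∷ ys' , cong suc len , λ { (here z≡y) _ → here z≡y ; (there z∈ys) z≢x → there (keep z∈ys z≢x) }

length-≤-injectiveOn : (f : X → Y) {xs : List X} {ys : List Y} → Unique xs →
                       (∀ {x y} → x ∈ xs → y ∈ xs → f x ≡ f y → x ≡ y) →
                       (∀ {x} → x ∈ xs → f x ∈ ys) →
                       length xs ≤ length ys
length-≤-injectiveOn f {[]} _ _ _ = z≤n
length-≤-injectiveOn f {x ∷ xs} (x∉xs ∷ unique) injective into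
  with ∈⇒removal (into (here refl))
... | ys' , len , keep = subst (suc (length xs) ≤_) (sym len)
  (s≤s (length-≤-injectiveOn f unique
          (λ z∈xs w∈xs → injective (there z∈xs) (there w∈xs))
          (λ z∈xs → keep (into (there z∈xs))
                         (λ fz≡fx → All.lookup x∉xs z∈xs
                                      (sym (injective (there z∈xs) (here refl) fz≡fx))))))

module _ {nA nB : ℕ} (Ms : Matching nA nB) where

  matchedVertices : List (Fin nA ⊎ Fin nB)
  matchedVertices = map inj₁ (map proj₁ Ms) ++ map inj₂ (map proj₂ Ms)

  length-matchedVertices : length matchedVertices ≡ 2 * length Ms
  length-matchedVertices = begin
    length matchedVertices
      ≡⟨ length-++ (map inj₁ (map proj₁ Ms)) ⟩
    length (map inj₁ (map proj₁ Ms)) + length (map inj₂ (map proj₂ Ms))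
      ≡⟨ cong₂ _+_ (lengthTwice inj₁ proj₁) (lengthTwice inj₂ proj₂) ⟩
    length Ms + length Ms
      ≡⟨ cong (length Ms +_) (sym (+-identityʳ (length Ms))) ⟩
    2 * length Ms ∎
    where
      open ≡-Reasoning
      lengthTwice : ∀ {Z V : Set} (g : Z → V) (h : Fin nA × Fin nB → Z) →
                    length (map g (map h Ms)) ≡ length Ms
      lengthTwice g h = trans (length-map g (map h Ms)) (length-map h Ms)

module _ {nA nB : ℕ} (G : Instance nA nB) (Ms : Matching nA nB) where

  inXA⇒∈ : ∀ {a} → T (inXA G Ms a) → a ∈ map proj₁ Ms
  inXA⇒∈ t = map⁺ (Any.map toWitness (any⁻ _ Ms t))

  inXB⇒∈ : ∀ {b} → T (inXB G Ms b) → b ∈ map proj₂ Ms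
  inXB⇒∈ t = map⁺ (Any.map toWitness (any⁻ _ Ms t))

  edge-G'⇒marked : ∀ {a b} → Edge (G' G Ms) a b → T (marked G Ms a b)
  edge-G'⇒marked {a} e = proj₂ (∈-filter⁻ (λ b → T? (marked G Ms a b)) {xs = prefA G a} e)

  marked⇒covered : ∀ {a b} → T (marked G Ms a b) → T (inXA G Ms a) ⊎ T (inXB G Ms b)
  marked⇒covered t with Equivalence.to T-∨ t
  ... | inj₁ byA = inj₁ (proj₁ (Equivalence.to T-∧ byA))
  ... | inj₂ byB = inj₂ (proj₁ (Equivalence.to T-∧ byB))

  cover : Fin nA × Fin nB → Fin nA ⊎ Fin nB
  cover (a , b) = if inXA G Ms a then inj₁ a else inj₂ b

  cover-∈ : ∀ {a b} → T (marked G Ms a b) → cover (a , b) ∈ matchedVertices Ms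
  cover-∈ {a} {b} t with inXA G Ms a in matchedA | marked⇒covered t
  ... | true  | _ = ∈-++⁺ˡ (∈-map⁺ inj₁ (inXA⇒∈ (subst T (sym matchedA) _)))
  ... | false | inj₂ tB = ∈-++⁺ʳ _ (∈-map⁺ inj₂ (inXB⇒∈ tB))
  ... | false | inj₁ ()

  cover-injectiveOn : ∀ {H : Instance nA nB} {M} → IsMatching H M →
                      ∀ {x y} → x ∈ M → y ∈ M → cover x ≡ cover y → x ≡ y
  cover-injectiveOn isM {a , b} {a' , b'} x∈M y∈M same
    with inXA G Ms a | inXA G Ms a' | same
  ... | true  | true  | refl with refl ← IsMatching.agentOK isM x∈M y∈M = refl
  ... | false | false | refl with refl ← IsMatching.resOK isM x∈M y∈M = refl

-- Only the marking is used: the bound holds for every matching of G', so the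
-- stability-type hypotheses and well-formedness are deliberately ignored.
corollary2 : ∀ {nA nB : ℕ} (G : Instance nA nB) → WellFormed G
    → (Ms : Matching nA nB) → IsMatching G Ms → Stable G Ms → Feasible G Ms
    → (M : Matching nA nB) → IsMatching (G' G Ms) M → RelaxedStable (G' G Ms) M
    → length M ≤ 2 * length Ms
corollary2 G _ Ms _ _ _ M isM _ = begin
  length M
    ≤⟨ length-≤-injectiveOn (cover G Ms) (IsMatching.noDup isM) (cover-injectiveOn G Ms isM)
         (λ e∈M → cover-∈ G Ms (edge-G'⇒marked G Ms (IsMatching.edges isM e∈M))) ⟩
  length (matchedVertices Ms)
    ≡⟨ length-matchedVertices Ms ⟩
  2 * length Ms ∎
  where open ≤-Reasoning
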